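{- Let $\mathsf L\in\{\mathsf L_\Diamond,\mathsf L^\forall_\Diamond\}$ and let $\mathcal A,\mathcal B$ be classes of pointed models such that some $\mathbf a\in\mathcal A$ is $\mathsf L$-bisimilar to some $\mathbf b\in\mathcal B$. Then for every complexity measure $\mu:\mathsf L\to\mathbb N$ and every $m\in\mathbb N$, Hercules has no winning strategy for the $(\mathsf L,\langle\mathcal A,\mathcal B\rangle)$ formula-complexity game on models with $\mu$ below $m$.
   Context: Fix a countably infinite set $P$ of propositional variables. $\mathsf L^\forall_\Diamond$ is the set of negation-normal-form formulas built from literals $p,\overline p$ ($p\in P$), $\bot,\top$ with $\vee,\wedge,\Diamond,\Box,\exists,\forall$ (universal modalities); $\mathsf L_\Diamond$ is the fragment without $\exists,\forall$. A model is $(W,R,V)$ with $W\neq\emptyset$, $R\subseteq W\times W$, $V:W\to2^P$; pointed models $(\mathcal M,a)$; standard Kripke semantics. $\mathsf L_\Diamond$-bisimilarity is ordinary bisimilarity of pointed models; $\mathsf L^\forall_\Diamond$-bisimilarity additionally requires the bisimulation to be total in both directions. For $\mathbf a=(\mathcal M,a)$: $\Box\mathbf a=\{(\mathcal M,b):aRb\}$, $\forall\mathbf a=\{(\mathcal M,b):b\in W\}$. The $(\mathsf L,\langle\mathcal A,\mathcal B\rangle)$ game on models: Hercules and the Hydra build a tree whose nodes $\eta$ carry a pair $\langle\mathfrak L(\eta),\mathfrak R(\eta)\rangle$ of classes of pointed models and a symbol; the root is labelled $\langle\mathcal A,\mathcal B\rangle$ and is a head. While heads remain, Hercules picks a head $\eta$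 and plays: Literal $\iota$ with $\mathfrak L(\eta)\models\iota$, $\mathfrak R(\eta)\models\neg\iota$ (stub); $\bot$ if $\mathfrak L(\eta)=\emptyset$ (stub); $\top$ if $\mathfrak R(\eta)=\emptyset$ (stub); $\vee$: split $\mathfrak L(\eta)=\mathcal L_1\cup\mathcal L_2$, two daughter heads $\langle\mathcal L_i,\mathfrak R(\eta)\rangle$; $\wedge$: split $\mathfrak R(\eta)=\mathcal R_1\cup\mathcal R_2$, daughters $\langle\mathfrak L(\eta),\mathcal R_i\rangle$; $\Diamond$: Hercules picks one element of $\Box\mathbf l$ for each $\mathbf l\in\mathfrak L(\eta)$ (impossible if one is empty), the Hydra picks a subset of $\Box\mathbf r$ for each $\mathbf r\in\mathfrak R(\eta)$, one daughter head with these classes; $\Box$: dual (Hercules chooses for the right side, Hydra subsets for the left); $\exists,\forall$ (only in $\mathsf L^\forall_\Diamond$): as $\Diamond,\Box$ with $\forall\mathbf a$ instead of $\Box\mathbf a$. The game ends when no heads remain, with closed tree $T$; $\psi_T$ is the formula whose syntax tree is $T$ and $\mu(T)=\mu(\psi_T)$. Hercules has a winning strategy with $\mu$ below $m$ if, however the Hydra plays, the game ends in finite time with a closed tree $T$ with $\mu(T)<m$. -}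

module Defs where

open import Level using (Level) renaming (suc to lsuc; zero to lzero)
open import Data.Nat using (ℕ; _<_)
open import Data.Bool using (Bool; true; false)
open import Data.Maybe using (Maybe; just; nothing; _>>=_)
open import Data.Product using (Σ; _×_; _,_; proj₁)
open import Data.Sum using (_⊎_)
open import Data.Unit using (⊤)
open import Relation.Binary.PropositionalEquality using (_≡_)
open import Relation.Nullary using (¬_)

-- Propositional variables: P = ℕ (countably infinite).

-- Models (W , R , V).  W is nonempty in every pointed model (it has a point).
record Model : Set₁ where
  field
    W : Set
    R : W → W → Set
    V : W → ℕ → Bool      -- V : W → 2^P as characteristic functions

open Model public

record PM : Set₁ where
  constructor _,ₚ_
  field
    model : Model
    point : W model

open PM public

Class : Set₂
Class = PM → Set₁

_⊆_ : Class → Class → Set₁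
A ⊆ B = ∀ x → A x → B x

at : (x : PM) → W (model x) → PM
at x b = model x ,ₚ b

Succ : PM → Class
Succ x y = Σ (W (model x)) λ b → R (model x) (point x) b × (y ≡ at x b)

Every : PM → Class
Every x y = Σ (W (model x)) λ b → y ≡ at x b

data Lang : Set where
  basic : Lang
  univ  : Lang

data Univ : Lang → Set where
  isUniv : Univ univ

-- Negation-normal-form formulas; ∃/∀ only available in L^∀_◇.
data Form (ℓ : Lang) : Set where
  pos neg : ℕ → Form ℓ
  ⊥f ⊤f   : Form ℓ
  _∨f_ _∧f_ : Form ℓ → Form ℓ → Form ℓ
  ◇f □f   : Form ℓ → Form ℓ
  ∃f ∀f   : Univ ℓ → Form ℓ → Form ℓ

data Lit : Set where
  posL negL : ℕ → Lit

Sat : PM → Lit → Set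
Sat x (posL p) = V (model x) (point x) p ≡ true
Sat x (negL p) = V (model x) (point x) p ≡ false

Total : Lang → {M N : Model} → (W M → W N → Set) → Set
Total basic Z = ⊤
Total univ {M} {N} Z = (∀ w → Σ (W N) λ v → Z w v) × (∀ v → Σ (W M) λ w → Z w v)

record IsBisim (ℓ : Lang) (M N : Model) (Z : W M → W N → Set) : Set where
  field
    atoms : ∀ {w v} → Z w v → ∀ p → V M w p ≡ V N v p
    forth : ∀ {w v w'} → Z w v → R M w w' → Σ (W N) λ v' → R N v v' × Z w' v'
    back  : ∀ {w v v'} → Z w v → R N v v' → Σ (W M) λ w' → R M w w' × Z w' v'
    total : Total ℓ {M} {N} Z

Bisimilar : Lang → PM → PM → Set₁
Bisimilar ℓ a b =
  Σ (W (model a) → W (model b) → Set) λ Z → IsBisim ℓ (model a) (model b) Z × Z (point a) (point b)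

-- The game.  Game states are partial syntax trees whose heads carry a
-- pair of classes ⟨𝔏(η), ℜ(η)⟩.

data PTree (ℓ : Lang) : Set₂ where
  hd      : Class → Class → PTree ℓ
  litT    : Lit → PTree ℓ
  ⊥T ⊤T   : PTree ℓ
  _∨T_ _∧T_ : PTree ℓ → PTree ℓ → PTree ℓ
  ◇T □T   : PTree ℓ → PTree ℓ
  ∃T ∀T   : Univ ℓ → PTree ℓ → PTree ℓ

data Pos {ℓ : Lang} : PTree ℓ → Class → Class → Set₂ where
  here : ∀ {L R} → Pos (hd L R) L R
  ∨l   : ∀ {s t L R} → Pos s L R → Pos (s ∨T t) L R
  ∨r   : ∀ {s t L R} → Pos t L R → Pos (s ∨T t) L R
  ∧l   : ∀ {s t L R} → Pos s L R → Pos (s ∧T t) L R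
  ∧r   : ∀ {s t L R} → Pos t L R → Pos (s ∧T t) L R
  ◇p   : ∀ {s L R} → Pos s L R → Pos (◇T s) L R
  □p   : ∀ {s L R} → Pos s L R → Pos (□T s) L R
  ∃p   : ∀ {u s L R} → Pos s L R → Pos (∃T u s) L R
  ∀p   : ∀ {u s L R} → Pos s L R → Pos (∀T u s) L R

plug : ∀ {ℓ L R} (t : PTree ℓ) → Pos t L R → PTree ℓ → PTree ℓ
plug (hd _ _) here n = n
plug (s ∨T t) (∨l p) n = plug s p n ∨T t
plug (s ∨T t) (∨r p) n = s ∨T plug t p n
plug (s ∧T t) (∧l p) n = plug s p n ∧T t
plug (s ∧T t) (∧r p) n = s ∧T plug t p n
plug (◇T s) (◇p p) n = ◇T (plug s p n)
plug (□T s) (□p p) n = □T (plug s p n)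
plug (∃T u s) (∃p p) n = ∃T u (plug s p n)
plug (∀T u s) (∀p p) n = ∀T u (plug s p n)

toForm : ∀ {ℓ} → PTree ℓ → Maybe (Form ℓ)
toForm (hd _ _) = nothing
toForm (litT (posL p)) = just (pos p)
toForm (litT (negL p)) = just (neg p)
toForm ⊥T = just ⊥f
toForm ⊤T = just ⊤f
toForm (s ∨T t) = toForm s >>= λ φ → toForm t >>= λ ψ → just (φ ∨f ψ)
toForm (s ∧T t) = toForm s >>= λ φ → toForm t >>= λ ψ → just (φ ∧f ψ)
toForm (◇T s) = toForm s >>= λ φ → just (◇f φ)
toForm (□T s) = toForm s >>= λ φ → just (□f φ)
toForm (∃T u s) = toForm s >>= λ φ → just (∃f u φ)
toForm (∀T u s) = toForm s >>= λ φ → just (∀f u φ)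

-- Hercules' choice: one element of F l for each l ∈ L; its image class
Pick : (PM → Class) → Class → Set₁
Pick F L = (l : PM) → L l → Σ PM (F l)

Img : {F : PM → Class} (L : Class) → Pick F L → Class
Img L g x = Σ PM λ l → Σ (L l) λ h → proj₁ (g l h) ≡ x

-- Hydra's choice: a subset of F r for each r ∈ R; its union
record HChoice (F : PM → Class) (R : Class) : Set₂ where
  field
    sub   : (r : PM) → R r → Class
    subOk : ∀ r (h : R r) → sub r h ⊆ F r

open HChoice public

Union : {F : PM → Class} (R : Class) → HChoice F R → Class
Union R S x = Σ PM λ r → Σ (R r) λ h → sub S r h x

record Split (L L₁ L₂ : Class) : Set₂ where
  field
    cover : ∀ x → L x → L₁ x ⊎ L₂ x
    inc₁  : L₁ ⊆ L
    inc₂  : L₂ ⊆ L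

-- Inductive ⇒ every play ends in finite time; a strategy may depend on the full
-- history (the proof term continues inside each Hydra response).
data Wins (ℓ : Lang) (μ : Form ℓ → ℕ) (m : ℕ) : PTree ℓ → Set₂ where
  finish : ∀ {t φ} → toForm t ≡ just φ → μ φ < m → Wins ℓ μ m t
  litM : ∀ {t L R} (p : Pos t L R) (ι : Lit) →
         (∀ l → L l → Sat l ι) → (∀ r → R r → ¬ Sat r ι) →
         Wins ℓ μ m (plug t p (litT ι)) → Wins ℓ μ m t
  botM : ∀ {t L R} (p : Pos t L R) → (∀ l → ¬ L l) →
         Wins ℓ μ m (plug t p ⊥T) → Wins ℓ μ m t
  topM : ∀ {t L R} (p : Pos t L R) → (∀ r → ¬ R r) →
         Wins ℓ μ m (plug t p ⊤T) → Wins ℓ μ m t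
  orM  : ∀ {t L R} (p : Pos t L R) (L₁ L₂ : Class) → Split L L₁ L₂ →
         Wins ℓ μ m (plug t p (hd L₁ R ∨T hd L₂ R)) → Wins ℓ μ m t
  andM : ∀ {t L R} (p : Pos t L R) (R₁ R₂ : Class) → Split R R₁ R₂ →
         Wins ℓ μ m (plug t p (hd L R₁ ∧T hd L R₂)) → Wins ℓ μ m t
  diaM : ∀ {t L R} (p : Pos t L R) (g : Pick Succ L) →
         ((S : HChoice Succ R) → Wins ℓ μ m (plug t p (◇T (hd (Img L g) (Union R S))))) →
         Wins ℓ μ m t
  boxM : ∀ {t L R} (p : Pos t L R) (g : Pick Succ R) →
         ((S : HChoice Succ L) → Wins ℓ μ m (plug t p (□T (hd (Union L S) (Img R g))))) →
         Wins ℓ μ m t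
  exM  : ∀ {t L R} (u : Univ ℓ) (p : Pos t L R) (g : Pick Every L) →
         ((S : HChoice Every R) → Wins ℓ μ m (plug t p (∃T u (hd (Img L g) (Union R S))))) →
         Wins ℓ μ m t
  allM : ∀ {t L R} (u : Univ ℓ) (p : Pos t L R) (g : Pick Every R) →
         ((S : HChoice Every L) → Wins ℓ μ m (plug t p (∀T u (hd (Union L S) (Img R g))))) →
         Wins ℓ μ m t

HerculesWins : (ℓ : Lang) → Class → Class → (Form ℓ → ℕ) → ℕ → Set₂
HerculesWins ℓ A B μ m = Wins ℓ μ m (hd A B)

module Submission where

-- Call a pair of classes ⟨L , R⟩ inseparable when some l ∈ L is
-- L-bisimilar to some r ∈ R.  The proof maintains the invariant
-- "some head of the game tree carries an inseparable label", which
-- holds at the root by hypothesis.  A tree with a head is not closed,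
-- so the game never ends while the invariant holds.  Every move of
-- Hercules on an inseparable head either is illegal (literal moves,
-- because bisimilar models agree on literals; ⊥ and ⊤, because both
-- sides are nonempty) or, against a suitable answer of the Hydra,
-- produces a new inseparable head: a split keeps the bisimilar pair on
-- one side, and for ◇, □, ∃, ∀ the Hydra answers with all successors,
-- so the forth/back clauses (resp. totality) of the bisimulation match
-- Hercules' chosen successor with a bisimilar one.  Induction on the
-- winning strategy therefore yields a contradiction.

open import Defs
open import Data.Nat using (ℕ)
open import Data.Empty using (⊥; ⊥-elim)
open import Data.Product using (Σ; _×_; _,_; proj₁; proj₂)
open import Data.Sum using (_⊎_; inj₁; inj₂)
open import Data.Maybe using (just; nothing)
open import Relation.Nullary using (¬_)
open import Relation.Binary.PropositionalEquality using (_≡_; refl; sym; trans)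

Inseparable : Lang → Class → Class → Set₁
Inseparable ℓ L R = Σ PM λ a → Σ PM λ b → L a × R b × Bisimilar ℓ a b

bisimilar-literal : ∀ {ℓ a b} (ι : Lit) → Bisimilar ℓ a b → Sat a ι → Sat b ι
bisimilar-literal (posL p) (_ , bis , z) s = trans (sym (IsBisim.atoms bis z p)) s
bisimilar-literal (negL p) (_ , bis , z) s = trans (sym (IsBisim.atoms bis z p)) s

literal-cannot-separate : ∀ {ℓ L R} (ι : Lit) → Inseparable ℓ L R →
  (∀ l → L l → Sat l ι) → (∀ r → R r → ¬ Sat r ι) → ⊥
literal-cannot-separate ι (a , b , la , rb , ab) holdsL failsR =
  failsR b rb (bisimilar-literal ι ab (holdsL a la))

split-left : ∀ {ℓ L L₁ L₂ R} → Split L L₁ L₂ → Inseparable ℓ L R →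
  Inseparable ℓ L₁ R ⊎ Inseparable ℓ L₂ R
split-left sp (a , b , la , rb , ab) with Split.cover sp a la
... | inj₁ l₁a = inj₁ (a , b , l₁a , rb , ab)
... | inj₂ l₂a = inj₂ (a , b , l₂a , rb , ab)

split-right : ∀ {ℓ L R R₁ R₂} → Split R R₁ R₂ → Inseparable ℓ L R →
  Inseparable ℓ L R₁ ⊎ Inseparable ℓ L R₂
split-right sp (a , b , la , rb , ab) with Split.cover sp b rb
... | inj₁ r₁b = inj₁ (a , b , la , r₁b , ab)
... | inj₂ r₂b = inj₂ (a , b , la , r₂b , ab)

Forth : Lang → (PM → Class) → Set₁
Forth ℓ F = ∀ {a b a'} → Bisimilar ℓ a b → F a a' →
  Σ PM λ b' → F b b' × Bisimilar ℓ a' b'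

Back : Lang → (PM → Class) → Set₁
Back ℓ F = ∀ {a b b'} → Bisimilar ℓ a b → F b b' →
  Σ PM λ a' → F a a' × Bisimilar ℓ a' b'

succ-forth : ∀ {ℓ} → Forth ℓ Succ
succ-forth {b = b} (Z , bis , z) (w , aRw , refl) =
  let (v , bRv , z') = IsBisim.forth bis z aRw
  in at b v , (v , bRv , refl) , (Z , bis , z')

succ-back : ∀ {ℓ} → Back ℓ Succ
succ-back {a = a} (Z , bis , z) (v , bRv , refl) =
  let (w , aRw , z') = IsBisim.back bis z bRv
  in at a w , (w , aRw , refl) , (Z , bis , z')

-- With universal modalities, bisimulations are total, so all worlds are matched.
every-forth : Forth univ Every
every-forth {b = b} (Z , bis , _) (w , refl) =
  let (v , z') = proj₁ (IsBisim.total bis) w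
  in at b v , (v , refl) , (Z , bis , z')

every-back : Back univ Every
every-back {a = a} (Z , bis , _) (v , refl) =
  let (w , z') = proj₂ (IsBisim.total bis) v
  in at a w , (w , refl) , (Z , bis , z')

-- The Hydra's answer to a modal move: every available successor.
allSuccessors : {F : PM → Class} (C : Class) → HChoice F C
allSuccessors {F} C = record { sub = λ c _ → F c ; subOk = λ _ _ _ fcx → fcx }

pick-left : ∀ {ℓ} {F : PM → Class} {L R} → Forth ℓ F → (g : Pick F L) → Inseparable ℓ L R →
  Inseparable ℓ (Img L g) (Union R (allSuccessors {F} R))
pick-left forth g (a , b , la , rb , ab) =
  let (b' , fbb' , a'b') = forth ab (proj₂ (g a la))
  in proj₁ (g a la) , b' , (a , la , refl) , (b , rb , fbb') , a'b'

pick-right : ∀ {ℓ} {F : PM → Class} {L R} → Back ℓ F → (g : Pick F R) → Inseparable ℓ L R →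
  Inseparable ℓ (Union L (allSuccessors {F} L)) (Img R g)
pick-right back g (a , b , la , rb , ab) =
  let (a' , faa' , a'b') = back ab (proj₂ (g b rb))
  in a' , proj₁ (g b rb) , (a , la , faa') , (b , rb , refl) , a'b'

HasInseparableHead : ∀ {ℓ} → PTree ℓ → Set₂
HasInseparableHead {ℓ} t = Σ Class λ L → Σ Class λ R → Pos t L R × Inseparable ℓ L R

open-tree : ∀ {ℓ L R} {t : PTree ℓ} → Pos t L R → toForm t ≡ nothing
open-tree here = refl
open-tree (∨l p) rewrite open-tree p = refl
open-tree {t = s ∨T _} (∨r p) with toForm s
... | nothing = refl
... | just _ rewrite open-tree p = refl
open-tree (∧l p) rewrite open-tree p = refl
open-tree {t = s ∧T _} (∧r p) with toForm s
... | nothing = refl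
... | just _ rewrite open-tree p = refl
open-tree (◇p p) rewrite open-tree p = refl
open-tree (□p p) rewrite open-tree p = refl
open-tree (∃p p) rewrite open-tree p = refl
open-tree (∀p p) rewrite open-tree p = refl

move-head : ∀ {ℓ} {s t : PTree ℓ} → (∀ {L R} → Pos s L R → Pos t L R) →
  HasInseparableHead s → HasInseparableHead t
move-head f (L , R , p , i) = L , R , f p , i

plug-keeps : ∀ {ℓ L R L' R'} {t : PTree ℓ} (p : Pos t L R) (q : Pos t L' R')
  (n : PTree ℓ) → Inseparable ℓ L' R' → (Inseparable ℓ L R → HasInseparableHead n) →
  HasInseparableHead (plug t p n)
plug-keeps here here n i k = k i
plug-keeps (∨l p) (∨l q) n i k = move-head ∨l (plug-keeps p q n i k)
plug-keeps (∨l p) (∨r q) n i k = _ , _ , ∨r q , i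
plug-keeps (∨r p) (∨l q) n i k = _ , _ , ∨l q , i
plug-keeps (∨r p) (∨r q) n i k = move-head ∨r (plug-keeps p q n i k)
plug-keeps (∧l p) (∧l q) n i k = move-head ∧l (plug-keeps p q n i k)
plug-keeps (∧l p) (∧r q) n i k = _ , _ , ∧r q , i
plug-keeps (∧r p) (∧l q) n i k = _ , _ , ∧l q , i
plug-keeps (∧r p) (∧r q) n i k = move-head ∧r (plug-keeps p q n i k)
plug-keeps (◇p p) (◇p q) n i k = move-head ◇p (plug-keeps p q n i k)
plug-keeps (□p p) (□p q) n i k = move-head □p (plug-keeps p q n i k)
plug-keeps (∃p p) (∃p q) n i k = move-head ∃p (plug-keeps p q n i k)
plug-keeps (∀p p) (∀p q) n i k = move-head ∀p (plug-keeps p q n i k)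

either-head : ∀ {ℓ} {L₁ R₁ L₂ R₂ : Class} (node : PTree ℓ → PTree ℓ → PTree ℓ) →
  (∀ {s t L R} → Pos s L R → Pos (node s t) L R) →
  (∀ {s t L R} → Pos t L R → Pos (node s t) L R) →
  Inseparable ℓ L₁ R₁ ⊎ Inseparable ℓ L₂ R₂ →
  HasInseparableHead (node (hd L₁ R₁) (hd L₂ R₂))
either-head node left right (inj₁ i) = _ , _ , left here , i
either-head node left right (inj₂ i) = _ , _ , right here , i

no-win : ∀ {ℓ μ m} {t : PTree ℓ} → Wins ℓ μ m t → HasInseparableHead t → ⊥
no-win (finish closed _) (_ , _ , q , _) with trans (sym (open-tree q)) closed
... | ()
no-win (litM p ι holdsL failsR w) (_ , _ , q , i) =
  no-win w (plug-keeps p q _ i λ i' → ⊥-elim (literal-cannot-separate ι i' holdsL failsR))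
no-win (botM p emptyL w) (_ , _ , q , i) =
  no-win w (plug-keeps p q _ i λ (a , _ , la , _) → ⊥-elim (emptyL a la))
no-win (topM p emptyR w) (_ , _ , q , i) =
  no-win w (plug-keeps p q _ i λ (_ , b , _ , rb , _) → ⊥-elim (emptyR b rb))
no-win (orM p _ _ sp w) (_ , _ , q , i) =
  no-win w (plug-keeps p q _ i λ i' → either-head _∨T_ ∨l ∨r (split-left sp i'))
no-win (andM p _ _ sp w) (_ , _ , q , i) =
  no-win w (plug-keeps p q _ i λ i' → either-head _∧T_ ∧l ∧r (split-right sp i'))
no-win (diaM p g k) (_ , _ , q , i) =
  no-win (k (allSuccessors _)) (plug-keeps p q _ i λ i' → _ , _ , ◇p here , pick-left succ-forth g i')
no-win (boxM p g k) (_ , _ , q , i) =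
  no-win (k (allSuccessors _)) (plug-keeps p q _ i λ i' → _ , _ , □p here , pick-right succ-back g i')
no-win (exM isUniv p g k) (_ , _ , q , i) =
  no-win (k (allSuccessors _)) (plug-keeps p q _ i λ i' → _ , _ , ∃p here , pick-left every-forth g i')
no-win (allM isUniv p g k) (_ , _ , q , i) =
  no-win (k (allSuccessors _)) (plug-keeps p q _ i λ i' → _ , _ , ∀p here , pick-right every-back g i')

corollary3p4 : (ℓ : Lang) (A B : Class) →
    Σ PM (λ a → Σ PM (λ b → A a × B b × Bisimilar ℓ a b)) →
    (μ : Form ℓ → ℕ) (m : ℕ) → ¬ HerculesWins ℓ A B μ m
corollary3p4 ℓ A B bisimilarPair μ m strategy =
  no-win strategy (A , B , here , bisimilarPair)
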